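{- Let $P$ be a finite poset. Consider the following algorithm: start with $P_0:=P$; at step $m$, if $P_m$ contains an $N$, choose the diagonal edge $(b,c)$ of some $N$ in $P_m$ and let $P_{m+1}$ be obtained from $P_m$ by adding one new vertex $u$ on this edge (i.e. replacing the covering $b\prec c$ by $b\prec u\prec c$); stop when $P_m$ is $N$-free. Then every run of this algorithm terminates, and it stops on the poset $S_N(S_N(P))$ (up to isomorphism fixing $P$). In particular, the resulting poset and the number of steps do not depend on the particular choices of diagonal edges made at each step.
   Context: For a poset $P$, a covering pair is $(x,y)$ with $x<y$ and no $z$ with $x<z<y$; write $x\prec y$. $Diag(P)$ is the directed graph on $P$ whose edges are the covering pairs. $Inc(P)$ is the set of pairs of incomparable elements. Four elements $a,b,c,d\in P$ form an $N$ in $P$ if $b\prec c$, $a\prec c$, $b\prec d$ and $(a,d)\in Inc(P)$; the pair $(b,c)$ is then called the diagonal edge of this $N$. $P$ is $N$-free if it contains no $N$. $N_{diag}(P)$ denotes the set of diagonal edges of all $N$'s in $P$. Adding vertices $u_1,\dots,u_k$ on an edge $(x,y)$ of $Diag(P)$ means replacing that edge by the path $x\prec u_1\prec\cdots\prec u_k\prec y$ in the diagram and taking the reflexive-transitive closure as the new order. $S_N(P)$ is the poset obtained from $P$ by adding exactly one new vertex on each edge in $N_{diag}(P)$ and no vertex on the other edges. -}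

module Defs where

open import Data.Nat using (ℕ; zero; suc; _+_)
open import Data.Bool using (Bool; true; false; _∧_; _∨_; not; T)
open import Data.Fin using (Fin; zero; suc; splitAt; _↑ˡ_; _≟_)
open import Data.List using (List; []; _∷_; length; lookup; map; concatMap; filterᵇ)
open import Data.Bool.ListAction using (any)
open import Data.Product using (_×_; _,_; Σ; ∃)
open import Data.Sum using (_⊎_; inj₁; inj₂)
open import Data.Empty using (⊥)
open import Relation.Nullary using (¬_)
open import Relation.Nullary.Decidable using (⌊_⌋)
open import Relation.Binary.PropositionalEquality using (_≡_)
open import Function using (_∘_; id)
open import Function.Bundles using (_↔_; Inverse)

BRel : ℕ → Set
BRel n = Fin n → Fin n → Bool

record IsPoset {n : ℕ} (R : BRel n) : Set where
  field
    refl  : ∀ x → T (R x x)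
    antisym : ∀ x y → T (R x y) → T (R y x) → x ≡ y
    trans : ∀ x y z → T (R x y) → T (R y z) → T (R x z)

anyF : ∀ {n} → (Fin n → Bool) → Bool
anyF {zero}  f = false
anyF {suc n} f = f zero ∨ anyF (f ∘ suc)

eqF : ∀ {n} → Fin n → Fin n → Bool
eqF x y = ⌊ x ≟ y ⌋

module _ {n : ℕ} (R : BRel n) where
  lt : Fin n → Fin n → Bool
  lt x y = R x y ∧ not (eqF x y)

  cov : Fin n → Fin n → Bool
  cov x y = lt x y ∧ not (anyF (λ z → lt x z ∧ lt z y))

  inc : Fin n → Fin n → Bool
  inc a d = not (R a d) ∧ not (R d a)

  isN : Fin n → Fin n → Fin n → Fin n → Bool
  isN a b c d = cov b c ∧ cov a c ∧ cov b d ∧ inc a d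

  isDiag : Fin n → Fin n → Bool
  isDiag b c = anyF (λ a → anyF (λ d → isN a b c d))

  NFree : Set
  NFree = ∀ a b c d → ¬ T (isN a b c d)

allFin' : (n : ℕ) → List (Fin n)
allFin' zero = []
allFin' (suc n) = zero ∷ map suc (allFin' n)

allPairs : (n : ℕ) → List (Fin n × Fin n)
allPairs n = concatMap (λ b → map (b ,_) (allFin' n)) (allFin' n)

eqPair : ∀ {n} → Fin n × Fin n → Fin n × Fin n → Bool
eqPair (x , y) (u , v) = eqF x u ∧ eqF y v

reach : ∀ {m} → BRel m → ℕ → BRel m
reach E zero    x y = eqF x y
reach E (suc k) x y = eqF x y ∨ anyF (λ z → E x z ∧ reach E k z y)

-- paths of length ≤ m suffice on m vertices
closure : ∀ {m} → BRel m → BRel m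
closure {m} E = reach E m

-- Adding one new vertex on each edge of the list L (a list of covering pairs
-- of R, without repetition in our uses).  The new carrier is Fin (n + length L):
-- old vertices come first (_↑ˡ_), the i-th new vertex sits on edge lookup L i.
-- The new diagram removes the edges of L and adds b ≺ u_i ≺ c; the new order
-- is the reflexive-transitive closure of that diagram.
addOnDiag : ∀ {n} (R : BRel n) (L : List (Fin n × Fin n)) → BRel (n + length L)
addOnDiag {n} R L x y with splitAt n x | splitAt n y
... | inj₁ u | inj₁ v = cov R u v ∧ not (any (eqPair (u , v)) L)
... | inj₁ u | inj₂ j with lookup L j
...   | (b , c) = eqF u b
addOnDiag {n} R L x y | inj₂ i | inj₁ v with lookup L i
...   | (b , c) = eqF v c
addOnDiag {n} R L x y | inj₂ i | inj₂ j = false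

addOn : ∀ {n} (R : BRel n) (L : List (Fin n × Fin n)) → BRel (n + length L)
addOn R L = closure (addOnDiag R L)

diagList : ∀ {n} → BRel n → List (Fin n × Fin n)
diagList {n} R = filterᵇ (λ e → isDiag R (Data.Product.proj₁ e) (Data.Product.proj₂ e)) (allPairs n)
  where import Data.Product

sizeSN : ∀ {n} → BRel n → ℕ
sizeSN {n} R = n + length (diagList R)

SN : ∀ {n} (R : BRel n) → BRel (sizeSN R)
SN R = addOn R (diagList R)

embSNSN : ∀ {n} (R : BRel n) → Fin n → Fin (sizeSN (SN R))
embSNSN R = (λ x → x ↑ˡ length (diagList (SN R))) ∘ (λ x → x ↑ˡ length (diagList R))

data Run : (n : ℕ) → BRel n → (m : ℕ) → BRel m → ℕ → Set where
  done : ∀ {n} {R : BRel n} → Run n R n R 0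
  step : ∀ {n} {R : BRel n} {m} {R' : BRel m} {k} (b c : Fin n) →
         T (isDiag R b c) →
         Run (n + 1) (addOn R ((b , c) ∷ [])) m R' k →
         Run n R m R' (suc k)

runEmb : ∀ {n R m R' k} → Run n R m R' k → Fin n → Fin m
runEmb done = id
runEmb (step b c _ r) = runEmb r ∘ (λ x → x ↑ˡ 1)

record IsoFixing {n m₁ m₂ : ℕ} (R₁ : BRel m₁) (ι₁ : Fin n → Fin m₁)
                 (R₂ : BRel m₂) (ι₂ : Fin n → Fin m₂) : Set where
  field
    bij      : Fin m₁ ↔ Fin m₂
    order    : ∀ x y → R₁ x y ≡ R₂ (Inverse.to bij x) (Inverse.to bij y)
    fixesP   : ∀ v → Inverse.to bij (ι₁ v) ≡ ι₂ v

module Submission where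

-- Every poset reached by the algorithm is P with one new vertex on each edge of some set K
-- of covering pairs of P.  In such a subdivision the diagonals of N's are exactly the
-- unsubdivided edges β ≺ γ of P admitting a witness: a ≺ γ and β ≺ d (a ≠ β, d ≠ γ) with
-- a ≰ d or with a ≺ γ or β ≺ d subdivided.  Writing W K for the edges with a witness, a
-- step enlarges K by one edge of W K, the algorithm stops exactly when W K ⊆ K, and S_N
-- replaces K by K ∪ W K.  W is monotone, and the heart of the proof is that
-- D₂ = W ∅ ∪ W (W ∅) already satisfies W D₂ ⊆ D₂.  Hence every run stays inside D₂ and
-- ends on a W-closed set, which must contain the least one, D₂; so it ends on the
-- subdivision along D₂, which is S_N(S_N(P)), after |D₂| ≤ |P|² steps.

open import Defs
open import Data.Nat using (ℕ; zero; suc; _+_; _*_; _≤_; _<_; s≤s)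
open import Data.Nat.Properties using (<-≤-trans; +-identityʳ; +-assoc; +-cancelˡ-≤)
open import Data.Nat.Induction using (<-wellFounded)
open import Induction.WellFounded using (Acc; acc)
open import Data.Bool using (Bool; true; false; _∧_; _∨_; not; T; T?)
open import Data.Bool.Properties using (T-∧; T-∨; T-≡; T-irrelevant)
open import Data.Bool.ListAction using (any)
open import Data.Unit using (tt)
open import Data.Empty using (⊥; ⊥-elim)
open import Data.Fin using (Fin; zero; suc; _≟_; _↑ˡ_; _↑ʳ_; splitAt; join; combine)
open import Data.Fin.Properties
  using (splitAt-↑ˡ; splitAt-↑ʳ; join-splitAt; ↑ˡ-injective; ↑ʳ-injective; combine-injective; injective⇒≤)
open import Data.Fin.Permutation using (↔⇒≡)
open import Data.Fin.Subset using (Subset; ∣_∣; _⊂_) renaming (_∈_ to _∈ₛ_)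
open import Data.Fin.Subset.Properties using (p⊂q⇒∣p∣<∣q∣; ∣p∣≤n)
open import Data.Vec using (tabulate)
open import Data.Vec.Properties using (lookup∘tabulate; lookup⇒[]=; []=⇒lookup)
open import Data.List using (List; []; _∷_; _++_; length; lookup; map; concatMap; cartesianProduct; allFin)
open import Data.List.Properties using (map-tabulate)
open import Data.List.Membership.Propositional using (_∈_)
open import Data.List.Membership.Propositional.Properties
  using (∈-lookup; ∈-filter⁺; ∈-filter⁻; ∈-cartesianProduct⁺; ∈-allFin)
import Data.List.Relation.Unary.All as All
open import Data.List.Relation.Unary.AllPairs as AllPairs using (_∷_)
open import Data.List.Relation.Unary.Any as Any using (here)
open import Data.List.Relation.Unary.Any.Properties using (any⁺; any⁻; lookup-index)
open import Data.List.Relation.Unary.Unique.Propositional using (Unique)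
open import Data.List.Relation.Unary.Unique.Propositional.Properties using (filter⁺; cartesianProduct⁺; allFin⁺)
open import Data.Product using (Σ; _×_; _,_; proj₁; proj₂)
open import Data.Sum using (_⊎_; inj₁; inj₂; [_,_]′; map₁; map₂)
open import Data.Sum.Properties using (inj₁-injective)
open import Function using (_∘_; id; _↔_; Inverse; mk↔ₛ′)
open import Function.Bundles using (Equivalence)
open import Function.Properties.Inverse using (↔-trans; ↔-sym)
open import Relation.Nullary using (¬_; yes; no; Dec)
open import Relation.Nullary.Decidable using (toWitness; fromWitness; toWitnessFalse; fromWitnessFalse)
open import Relation.Binary.PropositionalEquality using (_≡_; _≢_; refl; sym; trans; cong; cong₂; subst; subst₂)

-- Unification cannot invert _∧_ and _∨_, so the first argument of these lemmas often has
-- to be supplied by hand.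
∧-intro : ∀ {a b} → T a → T b → T (a ∧ b)
∧-intro p q = Equivalence.from T-∧ (p , q)

∧-proj₁ : ∀ {a b} → T (a ∧ b) → T a
∧-proj₁ = proj₁ ∘ Equivalence.to T-∧

∧-proj₂ : ∀ {a b} → T (a ∧ b) → T b
∧-proj₂ = proj₂ ∘ Equivalence.to T-∧

∨-inj₁ : ∀ {a b} → T a → T (a ∨ b)
∨-inj₁ = Equivalence.from T-∨ ∘ inj₁

∨-inj₂ : ∀ {a b} → T b → T (a ∨ b)
∨-inj₂ = Equivalence.from T-∨ ∘ inj₂

∨-elim : ∀ {a b} → T (a ∨ b) → T a ⊎ T b
∨-elim = Equivalence.to T-∨

∨-resolveˡ : ∀ {a b} → ¬ T a → T (a ∨ b) → T b
∨-resolveˡ {true} ¬a _ = ⊥-elim (¬a tt)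
∨-resolveˡ {false} _ b = b

not-intro : ∀ {a} → ¬ T a → T (not a)
not-intro {true} ¬a = ¬a tt
not-intro {false} _ = tt

not-elim : ∀ {a} → T (not a) → ¬ T a
not-elim {true} ()

T-injective : ∀ {a b} → (T a → T b) → (T b → T a) → a ≡ b
T-injective {true} {true} _ _ = refl
T-injective {true} {false} f _ = ⊥-elim (f tt)
T-injective {false} {true} _ g = ⊥-elim (g tt)
T-injective {false} {false} _ _ = refl

_⊆_ : ∀ {n} → BRel n → BRel n → Set
K ⊆ K′ = ∀ {b c} → T (K b c) → T (K′ b c)

eqF-sound : ∀ {n} {x y : Fin n} → T (eqF x y) → x ≡ y
eqF-sound = toWitness

eqF-complete : ∀ {n} {x y : Fin n} → x ≡ y → T (eqF x y)
eqF-complete = fromWitness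

eqF-refl : ∀ {n} (x : Fin n) → T (eqF x x)
eqF-refl x = eqF-complete refl

not-eqF-sound : ∀ {n} {x y : Fin n} → T (not (eqF x y)) → x ≢ y
not-eqF-sound = toWitnessFalse

not-eqF-complete : ∀ {n} {x y : Fin n} → x ≢ y → T (not (eqF x y))
not-eqF-complete = fromWitnessFalse

anyF-intro : ∀ {n} (f : Fin n → Bool) x → T (f x) → T (anyF f)
anyF-intro f zero p = ∨-inj₁ p
anyF-intro f (suc x) p = ∨-inj₂ {f zero} (anyF-intro (f ∘ suc) x p)

anyF-elim : ∀ {n} (f : Fin n → Bool) → T (anyF f) → Σ (Fin n) (λ x → T (f x))
anyF-elim {suc n} f p with ∨-elim {f zero} p
... | inj₁ q = zero , q
... | inj₂ q with anyF-elim (f ∘ suc) q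
...   | x , r = suc x , r

¬anyF : ∀ {n} (f : Fin n → Bool) → (∀ x → ¬ T (f x)) → ¬ T (anyF f)
¬anyF f none p = none (proj₁ (anyF-elim f p)) (proj₂ (anyF-elim f p))

subset : ∀ {m} → (Fin m → Bool) → Subset m
subset = tabulate

∈-subset⁺ : ∀ {m} {f : Fin m → Bool} {z} → T (f z) → z ∈ₛ subset f
∈-subset⁺ {f = f} {z} p = lookup⇒[]= z (subset f) (trans (lookup∘tabulate f z) (Equivalence.to T-≡ p))

∈-subset⁻ : ∀ {m} {f : Fin m → Bool} {z} → z ∈ₛ subset f → T (f z)
∈-subset⁻ {f = f} {z} p = Equivalence.from T-≡ (trans (sym (lookup∘tabulate f z)) ([]=⇒lookup p))

∣subset∣-< : ∀ {m} {f g : Fin m → Bool} → (∀ z → T (f z) → T (g z)) →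
             ∀ w → T (g w) → ¬ T (f w) → ∣ subset f ∣ < ∣ subset g ∣
∣subset∣-< f⊆g w gw ¬fw = p⊂q⇒∣p∣<∣q∣
  ((λ z∈f → ∈-subset⁺ (f⊆g _ (∈-subset⁻ z∈f))) , w , ∈-subset⁺ gw , ¬fw ∘ ∈-subset⁻)

module FinitePoset {m : ℕ} (Q : BRel m) (isPoset : IsPoset Q) where
  open IsPoset isPoset renaming (refl to ≤-reflexive; antisym to ≤-antisym; trans to ≤-trans′)

  lt-intro : ∀ {x y} → T (Q x y) → x ≢ y → T (lt Q x y)
  lt-intro p x≢y = ∧-intro p (not-eqF-complete x≢y)

  lt⇒le : ∀ {x y} → T (lt Q x y) → T (Q x y)
  lt⇒le = ∧-proj₁

  lt⇒≢ : ∀ {x y} → T (lt Q x y) → x ≢ y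
  lt⇒≢ p = not-eqF-sound (∧-proj₂ p)

  lt-irrefl : ∀ {x} → ¬ T (lt Q x x)
  lt-irrefl p = lt⇒≢ p refl

  lt-asym : ∀ {x y} → T (lt Q x y) → ¬ T (Q y x)
  lt-asym p q = lt⇒≢ p (≤-antisym _ _ (lt⇒le p) q)

  lt-le-trans : ∀ {x y z} → T (lt Q x y) → T (Q y z) → T (lt Q x z)
  lt-le-trans p q = lt-intro (≤-trans′ _ _ _ (lt⇒le p) q) (λ { refl → lt-asym p q })

  lt-trans : ∀ {x y z} → T (lt Q x y) → T (lt Q y z) → T (lt Q x z)
  lt-trans p q = lt-le-trans p (lt⇒le q)

  cov⇒lt : ∀ {x y} → T (cov Q x y) → T (lt Q x y)
  cov⇒lt = ∧-proj₁

  cov⇒le : ∀ {x y} → T (cov Q x y) → T (Q x y)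
  cov⇒le = lt⇒le ∘ cov⇒lt

  betweenᵇ : Fin m → Fin m → Fin m → Bool
  betweenᵇ x y z = lt Q x z ∧ lt Q z y

  between-lower : ∀ {x y z} → T (betweenᵇ x y z) → T (lt Q x z)
  between-lower {x} {y} {z} = ∧-proj₁ {lt Q x z}

  between-upper : ∀ {x y z} → T (betweenᵇ x y z) → T (lt Q z y)
  between-upper {x} {y} {z} = ∧-proj₂ {lt Q x z}

  cov-nothing-between : ∀ {x y} → T (cov Q x y) → ∀ z → T (lt Q x z) → ¬ T (lt Q z y)
  cov-nothing-between {x} {y} c z x<z z<y =
    not-elim (∧-proj₂ c) (anyF-intro (betweenᵇ x y) z (∧-intro x<z z<y))

  cov-intro : ∀ {x y} → T (lt Q x y) → (∀ z → T (lt Q x z) → ¬ T (lt Q z y)) → T (cov Q x y)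
  cov-intro {x} {y} x<y empty = ∧-intro x<y (not-intro (¬anyF (betweenᵇ x y)
    (λ z p → empty z (between-lower p) (between-upper p))))

  cov-upper : ∀ {x y z} → T (cov Q x y) → T (lt Q x z) → T (Q z y) → z ≡ y
  cov-upper {z = z} c x<z z≤y with z ≟ _
  ... | yes z≡y = z≡y
  ... | no z≢y = ⊥-elim (cov-nothing-between c z x<z (lt-intro z≤y z≢y))

  cov-lower : ∀ {x y z} → T (cov Q x y) → T (Q x z) → T (lt Q z y) → z ≡ x
  cov-lower {x} {z = z} c x≤z z<y with z ≟ x
  ... | yes z≡x = z≡x
  ... | no z≢x = ⊥-elim (cov-nothing-between c z (lt-intro x≤z (z≢x ∘ sym)) z<y)

  cov-no-zigzag : ∀ {a b c d} → T (cov Q b c) → T (cov Q a c) → T (cov Q b d) → ¬ T (Q d a)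
  cov-no-zigzag b≺c a≺c b≺d d≤a =
    cov-nothing-between b≺c _ (lt-le-trans (cov⇒lt b≺d) d≤a) (cov⇒lt a≺c)

  cov-squeeze : ∀ {x y w} → T (cov Q x y) → T (Q x w) → T (Q w y) → w ≡ x ⊎ w ≡ y
  cov-squeeze {x} {y} {w} c x≤w w≤y with w ≟ x | w ≟ y
  ... | yes w≡x | _ = inj₁ w≡x
  ... | no _ | yes w≡y = inj₂ w≡y
  ... | no w≢x | no w≢y =
    ⊥-elim (cov-nothing-between c w (lt-intro x≤w (w≢x ∘ sym)) (lt-intro w≤y w≢y))

  between : Fin m → Fin m → Subset m
  between x y = subset (betweenᵇ x y)

  non-cover-between : ∀ {x y} → T (lt Q x y) → ¬ T (cov Q x y) →
                      Σ (Fin m) (λ w → T (lt Q x w) × T (lt Q w y))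
  non-cover-between {x} {y} x<y ¬c with T? (anyF (betweenᵇ x y))
  ... | yes p = let w , q = anyF-elim _ p in w , between-lower q , between-upper q
  ... | no ¬p = ⊥-elim (¬c (∧-intro x<y (not-intro ¬p)))

  ∣between∣-shrinks-above : ∀ {x w y} → T (lt Q x w) → T (lt Q w y) →
                            ∣ between x w ∣ < ∣ between x y ∣
  ∣between∣-shrinks-above {x} {w} {y} x<w w<y = ∣subset∣-< {f = betweenᵇ x w} {g = betweenᵇ x y}
    (λ z p → ∧-intro (between-lower p) (lt-trans (between-upper p) w<y)) w (∧-intro x<w w<y)
    (lt-irrefl ∘ between-upper)

  ∣between∣-shrinks-below : ∀ {x w y} → T (lt Q x w) → T (lt Q w y) →
                            ∣ between w y ∣ < ∣ between x y ∣
  ∣between∣-shrinks-below {x} {w} {y} x<w w<y = ∣subset∣-< {f = betweenᵇ w y} {g = betweenᵇ x y}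
    (λ z p → ∧-intro (lt-trans x<w (between-lower p)) (between-upper p)) w (∧-intro x<w w<y)
    (lt-irrefl ∘ between-lower)

  cover-above′ : ∀ {x y} → Acc _<_ ∣ between x y ∣ → T (lt Q x y) →
                 Σ (Fin m) (λ z → T (cov Q x z) × T (Q z y))
  cover-above′ {x} {y} (acc rec) x<y with T? (cov Q x y)
  ... | yes c = y , c , ≤-reflexive y
  ... | no ¬c =
    let w , x<w , w<y = non-cover-between x<y ¬c
        z , c , z≤w = cover-above′ (rec (∣between∣-shrinks-above x<w w<y)) x<w
    in z , c , ≤-trans′ _ _ _ z≤w (lt⇒le w<y)

  cover-above : ∀ {x y} → T (lt Q x y) → Σ (Fin m) (λ z → T (cov Q x z) × T (Q z y))
  cover-above = cover-above′ (<-wellFounded _)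

  cover-below′ : ∀ {x y} → Acc _<_ ∣ between x y ∣ → T (lt Q x y) →
                 Σ (Fin m) (λ z → T (Q x z) × T (cov Q z y))
  cover-below′ {x} {y} (acc rec) x<y with T? (cov Q x y)
  ... | yes c = x , ≤-reflexive x , c
  ... | no ¬c =
    let w , x<w , w<y = non-cover-between x<y ¬c
        z , w≤z , c = cover-below′ (rec (∣between∣-shrinks-below x<w w<y)) w<y
    in z , ≤-trans′ _ _ _ (lt⇒le x<w) w≤z , c

  cover-below : ∀ {x y} → T (lt Q x y) → Σ (Fin m) (λ z → T (Q x z) × T (cov Q z y))
  cover-below = cover-below′ (<-wellFounded _)

  module Closure (E : BRel m) (E⊆Q : ∀ {x y} → T (E x y) → T (Q x y))
                 (cov⊆E : ∀ {x y} → T (cov Q x y) → T (E x y)) where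

    reach-sound : ∀ k {x y} → T (reach E k x y) → T (Q x y)
    reach-sound zero {x} p = subst (T ∘ Q x) (eqF-sound p) (≤-reflexive x)
    reach-sound (suc k) {x} {y} p with ∨-elim {eqF x y} p
    ... | inj₁ x≡y = subst (T ∘ Q x) (eqF-sound x≡y) (≤-reflexive x)
    ... | inj₂ q with anyF-elim (λ z → E x z ∧ reach E k z y) q
    ...   | z , r = ≤-trans′ _ _ _ (E⊆Q (∧-proj₁ r)) (reach-sound k (∧-proj₂ {E x z} r))

    reach-refl : ∀ k x → T (reach E k x x)
    reach-refl zero x = eqF-refl x
    reach-refl (suc k) x = ∨-inj₁ (eqF-refl x)

    intervalᵇ : Fin m → Fin m → Fin m → Bool
    intervalᵇ x y w = lt Q x w ∧ Q w y

    interval : Fin m → Fin m → Subset m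
    interval x y = subset (intervalᵇ x y)

    ∣interval∣-shrinks : ∀ {x z y} → T (lt Q x z) → T (Q z y) → ∣ interval z y ∣ < ∣ interval x y ∣
    ∣interval∣-shrinks {x} {z} {y} x<z z≤y = ∣subset∣-< {f = intervalᵇ z y} {g = intervalᵇ x y}
      (λ w p → ∧-intro (lt-trans x<z (∧-proj₁ {lt Q z w} p)) (∧-proj₂ {lt Q z w} p))
      z (∧-intro x<z z≤y) (lt-irrefl ∘ ∧-proj₁ {lt Q z z})

    -- k = 0 is impossible once x < y, as the interval (x, y] then contains the cover z.
    reach-complete : ∀ k {x y} → ∣ interval x y ∣ ≤ k → T (Q x y) → T (reach E k x y)
    reach-complete k {x} {y} size≤k x≤y with x ≟ y
    ... | yes refl = reach-refl k x
    ... | no x≢y with cover-above (lt-intro x≤y x≢y)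
    ...   | z , x≺z , z≤y with k | <-≤-trans (∣interval∣-shrinks (cov⇒lt x≺z) z≤y) size≤k
    ...     | suc k | s≤s shrunk = ∨-inj₂ {eqF x y}
      (anyF-intro (λ z → E x z ∧ reach E k z y) z (∧-intro (cov⊆E x≺z) (reach-complete k shrunk z≤y)))

    closure≡order : ∀ x y → closure E x y ≡ Q x y
    closure≡order x y = T-injective (reach-sound m) (reach-complete m (∣p∣≤n (interval x y)))

module _ {m : ℕ} (Q : BRel m) where

  record IsN (a b c d : Fin m) : Set where
    field
      b≺c : T (cov Q b c)
      a≺c : T (cov Q a c)
      b≺d : T (cov Q b d)
      a≰d : ¬ T (Q a d)
      d≰a : ¬ T (Q d a)

  isN-sound : ∀ {a b c d} → T (isN Q a b c d) → IsN a b c d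
  isN-sound {a} {b} {c} {d} p = record
    { b≺c = ∧-proj₁ p
    ; a≺c = ∧-proj₁ p₁
    ; b≺d = ∧-proj₁ p₂
    ; a≰d = not-elim (∧-proj₁ p₃)
    ; d≰a = not-elim (∧-proj₂ {not (Q a d)} p₃)
    }
    where
    p₁ = ∧-proj₂ {cov Q b c} p
    p₂ = ∧-proj₂ {cov Q a c} p₁
    p₃ = ∧-proj₂ {cov Q b d} p₂

  isN-complete : ∀ {a b c d} → IsN a b c d → T (isN Q a b c d)
  isN-complete N = ∧-intro b≺c (∧-intro a≺c (∧-intro b≺d (∧-intro (not-intro a≰d) (not-intro d≰a))))
    where open IsN N

  isDiag-elim : ∀ {b c} → T (isDiag Q b c) → Σ (Fin m) (λ a → Σ (Fin m) (λ d → IsN a b c d))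
  isDiag-elim {b} {c} p with anyF-elim (λ a → anyF (λ d → isN Q a b c d)) p
  ... | a , q with anyF-elim (λ d → isN Q a b c d) q
  ...   | d , r = a , d , isN-sound r

  isDiag-intro : ∀ {a b c d} → IsN a b c d → T (isDiag Q b c)
  isDiag-intro {a} {b} {c} {d} N =
    anyF-intro (λ a → anyF (λ d → isN Q a b c d)) a (anyF-intro (λ d → isN Q a b c d) d (isN-complete N))

module Subdivision {n : ℕ} (R : BRel n) (isPoset : IsPoset R) where
  open IsPoset isPoset renaming (refl to ≤-reflexive; antisym to ≤-antisym; trans to ≤-trans)
  open FinitePoset R isPoset public

  Edge : BRel n → Set
  Edge K = Σ (Fin n) (λ b → Σ (Fin n) (λ c → T (K b c)))

  Vertex : BRel n → Set
  Vertex K = Fin n ⊎ Edge K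

  OnCovers : BRel n → Set
  OnCovers K = ∀ {b c} → T (K b c) → T (cov R b c)

  new-≡ : ∀ {K} {b b′ c c′} {t : T (K b c)} {t′ : T (K b′ c′)} → b ≡ b′ → c ≡ c′ →
          _≡_ {A = Vertex K} (inj₂ (b , c , t)) (inj₂ (b′ , c′ , t′))
  new-≡ {t = t} {t′} refl refl = cong (λ s → inj₂ (_ , _ , s)) (T-irrelevant t t′)

  eqF²-sound : ∀ {b b′ c c′ : Fin n} → T (eqF b b′ ∧ eqF c c′) → b ≡ b′ × c ≡ c′
  eqF²-sound {b} {b′} p = eqF-sound (∧-proj₁ {eqF b b′} p) , eqF-sound (∧-proj₂ {eqF b b′} p)

  new-≡ᵇ : ∀ {K} {b b′ c c′} {t : T (K b c)} {t′ : T (K b′ c′)} → T (eqF b b′ ∧ eqF c c′) →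
           _≡_ {A = Vertex K} (inj₂ (b , c , t)) (inj₂ (b′ , c′ , t′))
  new-≡ᵇ p = new-≡ (proj₁ (eqF²-sound p)) (proj₂ (eqF²-sound p))

  subOrder : ∀ {K} → Vertex K → Vertex K → Bool
  subOrder (inj₁ p) (inj₁ q) = R p q
  subOrder (inj₁ p) (inj₂ (b , c , _)) = R p b
  subOrder (inj₂ (b , c , _)) (inj₁ q) = R c q
  subOrder (inj₂ (b , c , _)) (inj₂ (b′ , c′ , _)) = (eqF b b′ ∧ eqF c c′) ∨ R c b′

  subCover : ∀ {K} → Vertex K → Vertex K → Bool
  subCover {K} (inj₁ p) (inj₁ q) = cov R p q ∧ not (K p q)
  subCover (inj₁ p) (inj₂ (b , c , _)) = eqF p b
  subCover (inj₂ (b , c , _)) (inj₁ q) = eqF c q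
  subCover (inj₂ _) (inj₂ _) = false

  module SubdivisionPoset {K : BRel n} (onCovers : OnCovers K) where

    edge-lt : ∀ {b c} → T (K b c) → T (lt R b c)
    edge-lt = cov⇒lt ∘ onCovers

    subOrder-refl : ∀ (v : Vertex K) → T (subOrder v v)
    subOrder-refl (inj₁ p) = ≤-reflexive p
    subOrder-refl (inj₂ (b , c , _)) = ∨-inj₁ (∧-intro (eqF-refl b) (eqF-refl c))

    subOrder-antisym : ∀ (v w : Vertex K) → T (subOrder v w) → T (subOrder w v) → v ≡ w
    subOrder-antisym (inj₁ p) (inj₁ q) v≤w w≤v = cong inj₁ (≤-antisym p q v≤w w≤v)
    subOrder-antisym (inj₁ p) (inj₂ (b , c , t)) p≤b c≤p = ⊥-elim (lt-asym (edge-lt t) (≤-trans c p b c≤p p≤b))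
    subOrder-antisym (inj₂ (b , c , t)) (inj₁ q) c≤q q≤b = ⊥-elim (lt-asym (edge-lt t) (≤-trans c q b c≤q q≤b))
    subOrder-antisym (inj₂ (b , c , t)) (inj₂ (b′ , c′ , t′)) v≤w w≤v
      with ∨-elim {eqF b b′ ∧ eqF c c′} v≤w | ∨-elim {eqF b′ b ∧ eqF c′ c} w≤v
    ... | inj₁ e | _ = new-≡ᵇ e
    ... | inj₂ _ | inj₁ e = sym (new-≡ᵇ e)
    ... | inj₂ c≤b′ | inj₂ c′≤b =
      ⊥-elim (lt-irrefl (lt-trans (lt-le-trans (edge-lt t) c≤b′) (lt-le-trans (edge-lt t′) c′≤b)))

    subOrder-trans : ∀ (u v w : Vertex K) → T (subOrder u v) → T (subOrder v w) → T (subOrder u w)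
    subOrder-trans (inj₁ p) (inj₁ q) (inj₁ r) u≤v v≤w = ≤-trans _ _ _ u≤v v≤w
    subOrder-trans (inj₁ p) (inj₁ q) (inj₂ _) u≤v v≤w = ≤-trans _ _ _ u≤v v≤w
    subOrder-trans (inj₁ p) (inj₂ (b , c , t)) (inj₁ r) u≤v v≤w =
      ≤-trans _ _ _ u≤v (≤-trans _ _ _ (lt⇒le (edge-lt t)) v≤w)
    subOrder-trans (inj₁ p) (inj₂ (b , c , t)) (inj₂ (b′ , c′ , t′)) u≤v v≤w with ∨-elim {eqF b b′ ∧ eqF c c′} v≤w
    ... | inj₁ e = subst (T ∘ R p) (proj₁ (eqF²-sound e)) u≤v
    ... | inj₂ c≤b′ = ≤-trans _ _ _ u≤v (≤-trans _ _ _ (lt⇒le (edge-lt t)) c≤b′)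
    subOrder-trans (inj₂ (b , c , t)) (inj₁ q) (inj₁ r) u≤v v≤w = ≤-trans _ _ _ u≤v v≤w
    subOrder-trans (inj₂ (b , c , t)) (inj₁ q) (inj₂ (b′ , c′ , t′)) u≤v v≤w =
      ∨-inj₂ {eqF b b′ ∧ eqF c c′} (≤-trans _ _ _ u≤v v≤w)
    subOrder-trans (inj₂ (b , c , t)) (inj₂ (b′ , c′ , t′)) (inj₁ r) u≤v v≤w with ∨-elim {eqF b b′ ∧ eqF c c′} u≤v
    ... | inj₁ e = subst (λ z → T (R z r)) (sym (proj₂ (eqF²-sound e))) v≤w
    ... | inj₂ c≤b′ = ≤-trans _ _ _ c≤b′ (≤-trans _ _ _ (lt⇒le (edge-lt t′)) v≤w)
    subOrder-trans u@(inj₂ (b , c , t)) (inj₂ (b′ , c′ , t′)) w@(inj₂ (b″ , c″ , t″)) u≤v v≤w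
      with ∨-elim {eqF b b′ ∧ eqF c c′} u≤v | ∨-elim {eqF b′ b″ ∧ eqF c′ c″} v≤w
    ... | inj₁ e | _ = subst (λ v → T (subOrder v w)) (sym (new-≡ᵇ {t = t} {t′} e)) v≤w
    ... | inj₂ _ | inj₁ e = subst (T ∘ subOrder u) (new-≡ᵇ {t = t′} {t″} e) u≤v
    ... | inj₂ c≤b′ | inj₂ c′≤b″ =
      ∨-inj₂ {eqF b b″ ∧ eqF c c″} (≤-trans _ _ _ c≤b′ (≤-trans _ _ _ (lt⇒le (edge-lt t′)) c′≤b″))

    _⊏_ : Vertex K → Vertex K → Set
    v ⊏ w = T (subOrder v w) × v ≢ w

    ⊏-old : ∀ {p q} → inj₁ p ⊏ inj₁ q → T (lt R p q)
    ⊏-old (p≤q , p≢q) = lt-intro p≤q (p≢q ∘ cong inj₁)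

    subCover⇒⊏ : ∀ v w → T (subCover v w) → v ⊏ w
    subCover⇒⊏ (inj₁ p) (inj₁ q) c = lt⇒le (cov⇒lt p≺q) , lt⇒≢ (cov⇒lt p≺q) ∘ inj₁-injective
      where p≺q = ∧-proj₁ {cov R p q} c
    subCover⇒⊏ (inj₁ p) (inj₂ _) p≡b = subst (T ∘ R p) (eqF-sound p≡b) (≤-reflexive p) , λ ()
    subCover⇒⊏ (inj₂ (b , c , _)) (inj₁ q) c≡q = subst (T ∘ R c) (eqF-sound c≡q) (≤-reflexive c) , λ ()

    subCover-complete : ∀ v w → v ⊏ w → (∀ u → v ⊏ u → ¬ u ⊏ w) → T (subCover v w)
    subCover-complete (inj₁ p) (inj₁ q) v⊏w empty = ∧-intro
      (cov-intro (⊏-old v⊏w) (λ z p<z z<q →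
        empty (inj₁ z) (lt⇒le p<z , lt⇒≢ p<z ∘ inj₁-injective) (lt⇒le z<q , lt⇒≢ z<q ∘ inj₁-injective)))
      (not-intro (λ t → empty (inj₂ (p , q , t)) (≤-reflexive p , λ ()) (≤-reflexive q , λ ())))
    subCover-complete (inj₁ p) (inj₂ (b , c , t)) (p≤b , _) empty with p ≟ b
    ... | yes _ = _
    ... | no p≢b = ⊥-elim (empty (inj₁ b) (p≤b , p≢b ∘ inj₁-injective) (≤-reflexive b , λ ()))
    subCover-complete (inj₂ (b , c , t)) (inj₁ q) (c≤q , _) empty with c ≟ q
    ... | yes _ = _
    ... | no c≢q = ⊥-elim (empty (inj₁ c) (≤-reflexive c , λ ()) (c≤q , c≢q ∘ inj₁-injective))
    subCover-complete (inj₂ (b , c , t)) (inj₂ (b′ , c′ , t′)) (v≤w , v≢w) empty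
      with ∨-elim {eqF b b′ ∧ eqF c c′} v≤w
    ... | inj₁ e = ⊥-elim (v≢w (new-≡ᵇ e))
    ... | inj₂ c≤b′ = ⊥-elim (empty (inj₁ c) (≤-reflexive c , λ ()) (c≤b′ , λ ()))

    subCover-nothing-between : ∀ v w → T (subCover v w) → ∀ u → v ⊏ u → ¬ u ⊏ w
    subCover-nothing-between (inj₁ p) (inj₁ q) c (inj₁ r) p⊏r r⊏q =
      cov-nothing-between (∧-proj₁ {cov R p q} c) r (⊏-old p⊏r) (⊏-old r⊏q)
    subCover-nothing-between (inj₁ p) (inj₁ q) c (inj₂ (b , c′ , t)) (p≤b , _) (c′≤q , _)
      with cov-squeeze (∧-proj₁ {cov R p q} c) p≤b (≤-trans _ _ _ (lt⇒le (edge-lt t)) c′≤q)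
    ... | inj₂ refl = lt-asym (edge-lt t) c′≤q
    ... | inj₁ refl with cov-squeeze (∧-proj₁ {cov R p q} c) (lt⇒le (edge-lt t)) c′≤q
    ...   | inj₁ refl = lt-irrefl (edge-lt t)
    ...   | inj₂ refl = not-elim (∧-proj₂ {cov R p q} c) t
    subCover-nothing-between (inj₁ p) (inj₂ _) p≡b (inj₁ r) (p≤r , p≢r) (r≤b , _)
      with eqF-sound {x = p} p≡b
    ... | refl = p≢r (cong inj₁ (≤-antisym p r p≤r r≤b))
    subCover-nothing-between (inj₁ p) (inj₂ (b , c , t)) p≡b (inj₂ (b′ , c′ , t′)) (p≤b′ , _) (u≤w , u≢w)
      with eqF-sound {x = p} p≡b | ∨-elim {eqF b′ b ∧ eqF c′ c} u≤w
    ... | refl | inj₁ e = u≢w (new-≡ᵇ e)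
    ... | refl | inj₂ c′≤p = lt-asym (lt-le-trans (edge-lt t′) c′≤p) p≤b′
    subCover-nothing-between (inj₂ (b , c , t)) (inj₁ q) c≡q (inj₁ r) (c≤r , _) (r≤q , r≢q)
      with eqF-sound {x = c} c≡q
    ... | refl = r≢q (cong inj₁ (≤-antisym r c r≤q c≤r))
    subCover-nothing-between (inj₂ (b , c , t)) (inj₁ q) c≡q (inj₂ (b′ , c′ , t′)) (v≤u , v≢u) (c′≤q , _)
      with eqF-sound {x = c} c≡q | ∨-elim {eqF b b′ ∧ eqF c c′} v≤u
    ... | refl | inj₁ e = v≢u (new-≡ᵇ e)
    ... | refl | inj₂ c≤b′ = lt-asym (lt-le-trans (edge-lt t′) c′≤q) c≤b′

module Diagonals {n : ℕ} (R : BRel n) (isPoset : IsPoset R) where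
  open IsPoset isPoset using () renaming (refl to ≤-reflexive)
  open Subdivision R isPoset public

  record IsSubdivision (K : BRel n) {m : ℕ} (Q : BRel m) (ι : Fin n → Fin m) : Set where
    field
      onCovers : OnCovers K
      vertices : Fin m ↔ Vertex K
      order    : ∀ x y → Q x y ≡ subOrder (Inverse.to vertices x) (Inverse.to vertices y)
      embeds   : ∀ p → Inverse.to vertices (ι p) ≡ inj₁ p

  module IsSubdivisionProperties {K : BRel n} {m : ℕ} {Q : BRel m} {ι : Fin n → Fin m}
                                 (S : IsSubdivision K Q ι) where
    open IsSubdivision S
    open Inverse vertices using (to; from; strictlyInverseˡ; strictlyInverseʳ) public
    open SubdivisionPoset onCovers

    to-injective : ∀ {x y} → to x ≡ to y → x ≡ y
    to-injective {x} {y} e = trans (sym (strictlyInverseʳ x)) (trans (cong from e) (strictlyInverseʳ y))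

    ι-injective : ∀ {p q} → ι p ≡ ι q → p ≡ q
    ι-injective {p} {q} e = inj₁-injective (trans (sym (embeds p)) (trans (cong to e) (embeds q)))

    to-order : ∀ {x y} → T (Q x y) → T (subOrder (to x) (to y))
    to-order {x} {y} = subst T (order x y)

    from-order : ∀ {x y} → T (subOrder (to x) (to y)) → T (Q x y)
    from-order {x} {y} = subst T (sym (order x y))

    isPosetQ : IsPoset Q
    isPosetQ = record
      { refl = λ x → from-order (subOrder-refl (to x))
      ; antisym = λ x y x≤y y≤x → to-injective (subOrder-antisym _ _ (to-order x≤y) (to-order y≤x))
      ; trans = λ x y z x≤y y≤z → from-order (subOrder-trans (to x) (to y) (to z) (to-order x≤y) (to-order y≤z))
      }

    module Q = FinitePoset Q isPosetQ

    to-lt : ∀ {x y} → T (lt Q x y) → to x ⊏ to y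
    to-lt x<y = to-order (Q.lt⇒le x<y) , Q.lt⇒≢ x<y ∘ to-injective

    from-lt : ∀ {x y} → to x ⊏ to y → T (lt Q x y)
    from-lt (x≤y , x≢y) = Q.lt-intro (from-order x≤y) (x≢y ∘ cong to)

    from-lt-from : ∀ {x v} → to x ⊏ v → T (lt Q x (from v))
    from-lt-from {v = v} = from-lt ∘ subst (to _ ⊏_) (sym (strictlyInverseˡ v))

    from-lt-to : ∀ {v y} → v ⊏ to y → T (lt Q (from v) y)
    from-lt-to {v} = from-lt ∘ subst (_⊏ to _) (sym (strictlyInverseˡ v))

    to-cov : ∀ {x y} → T (cov Q x y) → T (subCover (to x) (to y))
    to-cov c = subCover-complete _ _ (to-lt (Q.cov⇒lt c))
      (λ u x⊏u u⊏y → Q.cov-nothing-between c (from u) (from-lt-from x⊏u) (from-lt-to u⊏y))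

    from-cov : ∀ {x y} → T (subCover (to x) (to y)) → T (cov Q x y)
    from-cov c = Q.cov-intro (from-lt (subCover⇒⊏ _ _ c))
      (λ z x<z z<y → subCover-nothing-between _ _ c (to z) (to-lt x<z) (to-lt z<y))

  -- The edge β ≺ γ of P carries the diagonal of an N in the subdivision along K exactly
  -- when it is not subdivided and has a witness in the following sense.
  record Witness (K : BRel n) (β γ : Fin n) : Set where
    constructor witness
    field
      a d       : Fin n
      a≺γ       : T (cov R a γ)
      β≺d       : T (cov R β d)
      a≢β       : a ≢ β
      d≢γ       : d ≢ γ
      separated : ¬ T (R a d) ⊎ T (K a γ) ⊎ T (K β d)

  separatedᵇ : BRel n → Fin n → Fin n → Fin n → Fin n → Bool
  separatedᵇ K β γ a d = not (R a d) ∨ K a γ ∨ K β d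

  witnessᵇ : BRel n → Fin n → Fin n → Fin n → Fin n → Bool
  witnessᵇ K β γ a d =
    cov R a γ ∧ cov R β d ∧ not (eqF a β) ∧ not (eqF d γ) ∧ separatedᵇ K β γ a d

  W : BRel n → BRel n
  W K β γ = cov R β γ ∧ anyF (λ a → anyF (witnessᵇ K β γ a))

  separatedᵇ-sound : ∀ {K β γ a d} → T (separatedᵇ K β γ a d) → ¬ T (R a d) ⊎ T (K a γ) ⊎ T (K β d)
  separatedᵇ-sound {K} {β} {γ} {a} {d} p with ∨-elim {not (R a d)} p
  ... | inj₁ ¬a≤d = inj₁ (not-elim ¬a≤d)
  ... | inj₂ q = inj₂ (∨-elim {K a γ} q)

  separatedᵇ-complete : ∀ {K β γ a d} → ¬ T (R a d) ⊎ T (K a γ) ⊎ T (K β d) → T (separatedᵇ K β γ a d)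
  separatedᵇ-complete (inj₁ ¬a≤d) = ∨-inj₁ (not-intro ¬a≤d)
  separatedᵇ-complete {K} {β} {γ} {a} {d} (inj₂ (inj₁ t)) = ∨-inj₂ {not (R a d)} (∨-inj₁ t)
  separatedᵇ-complete {K} {β} {γ} {a} {d} (inj₂ (inj₂ t)) = ∨-inj₂ {not (R a d)} (∨-inj₂ {K a γ} t)

  witnessᵇ-sound : ∀ {K β γ} a d → T (witnessᵇ K β γ a d) → Witness K β γ
  witnessᵇ-sound {K} {β} {γ} a d p = witness a d
    (∧-proj₁ p) (∧-proj₁ p₁) (not-eqF-sound (∧-proj₁ p₂)) (not-eqF-sound (∧-proj₁ p₃))
    (separatedᵇ-sound {K} {β} {γ} {a} {d} (∧-proj₂ {not (eqF d γ)} p₃))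
    where
    p₁ = ∧-proj₂ {cov R a γ} p
    p₂ = ∧-proj₂ {cov R β d} p₁
    p₃ = ∧-proj₂ {not (eqF a β)} p₂

  witnessᵇ-complete : ∀ {K β γ} (w : Witness K β γ) → T (witnessᵇ K β γ (Witness.a w) (Witness.d w))
  witnessᵇ-complete {K} (witness a d a≺γ β≺d a≢β d≢γ separated) = ∧-intro a≺γ (∧-intro β≺d
    (∧-intro (not-eqF-complete a≢β) (∧-intro (not-eqF-complete d≢γ) (separatedᵇ-complete {K} separated))))

  W-intro : ∀ {K β γ} → T (cov R β γ) → Witness K β γ → T (W K β γ)
  W-intro {K} {β} {γ} β≺γ w = ∧-intro β≺γ
    (anyF-intro (λ a → anyF (witnessᵇ K β γ a)) (Witness.a w)
      (anyF-intro (witnessᵇ K β γ (Witness.a w)) (Witness.d w) (witnessᵇ-complete w)))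

  W⇒cov : ∀ {K β γ} → T (W K β γ) → T (cov R β γ)
  W⇒cov {K} {β} {γ} = ∧-proj₁ {cov R β γ}

  W⇒witness : ∀ {K β γ} → T (W K β γ) → Witness K β γ
  W⇒witness {K} {β} {γ} p with anyF-elim (λ a → anyF (witnessᵇ K β γ a)) (∧-proj₂ {cov R β γ} p)
  ... | a , q with anyF-elim (witnessᵇ K β γ a) q
  ...   | d , r = witnessᵇ-sound a d r

  W-mono : ∀ {K K′} → K ⊆ K′ → W K ⊆ W K′
  W-mono {K} {K′} K⊆K′ {β} {γ} w with W⇒witness {K} {β} {γ} w
  ... | witness a d a≺γ β≺d a≢β d≢γ separated =
    W-intro {K′} (W⇒cov {K} w) (witness a d a≺γ β≺d a≢β d≢γ (map₂ (map₁ K⊆K′ ∘ map₂ K⊆K′) separated))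

  record DiagonalOver (K : BRel n) {A : Set} (ι : Fin n → A) (x y : A) : Set where
    constructor diagonalOver
    field
      β γ          : Fin n
      x≡ιβ         : x ≡ ι β
      y≡ιγ         : y ≡ ι γ
      unsubdivided : ¬ T (K β γ)
      witnessed    : T (W K β γ)

  module SubdivisionN {K : BRel n} (onCovers : OnCovers K) where
    open SubdivisionPoset onCovers

    old-edge-witness : ∀ {β γ} → ¬ T (K β γ) → ∀ (va vd : Vertex K) → T (subCover va (inj₁ γ)) →
                       T (subCover (inj₁ β) vd) → ¬ T (subOrder va vd) → Witness K β γ
    old-edge-witness {β} {γ} ¬βγ (inj₁ a) (inj₁ d) a≺γ β≺d a≰d = witness a d
      (∧-proj₁ {cov R a γ} a≺γ) (∧-proj₁ {cov R β d} β≺d)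
      (λ { refl → a≰d (cov⇒le (∧-proj₁ {cov R a d} β≺d)) })
      (λ { refl → a≰d (cov⇒le (∧-proj₁ {cov R a d} a≺γ)) }) (inj₁ a≰d)
    old-edge-witness {β} ¬βγ (inj₁ a) (inj₂ (b , d , t)) a≺γ β≡b a≰b with eqF-sound {x = β} β≡b
    ... | refl = witness a d (∧-proj₁ {cov R a _} a≺γ) (onCovers t)
      (λ { refl → a≰b (≤-reflexive a) }) (λ { refl → ¬βγ t }) (inj₂ (inj₂ t))
    old-edge-witness ¬βγ (inj₂ (a , c , t)) (inj₁ d) c≡γ β≺d c≰d with eqF-sound {x = c} c≡γ
    ... | refl = witness a d (onCovers t) (∧-proj₁ {cov R _ d} β≺d)
      (λ { refl → ¬βγ t }) (λ { refl → c≰d (≤-reflexive c) }) (inj₂ (inj₁ t))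
    old-edge-witness {β} ¬βγ (inj₂ (a , c , t)) (inj₂ (b , d , t′)) c≡γ β≡b _
      with eqF-sound {x = c} c≡γ | eqF-sound {x = β} β≡b
    ... | refl | refl = witness a d (onCovers t) (onCovers t′)
      (λ { refl → ¬βγ t }) (λ { refl → ¬βγ t′ }) (inj₂ (inj₁ t))

    record IsSubN (va vb vc vd : Vertex K) : Set where
      constructor isSubN
      field
        b≺c : T (subCover vb vc)
        a≺c : T (subCover va vc)
        b≺d : T (subCover vb vd)
        a⋢d : ¬ T (subOrder va vd)
        d⋢a : ¬ T (subOrder vd va)

    IsSubN-diagonal : ∀ (va vb vc vd : Vertex K) → IsSubN va vb vc vd → DiagonalOver K inj₁ vb vc
    IsSubN-diagonal va (inj₁ β) (inj₁ γ) vd N = diagonalOver β γ refl refl ¬βγ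
      (W-intro (∧-proj₁ {cov R β γ} b≺c) (old-edge-witness ¬βγ va vd a≺c b≺d a⋢d))
      where
      open IsSubN N
      ¬βγ = not-elim (∧-proj₂ {cov R β γ} b≺c)
    IsSubN-diagonal (inj₁ q) (inj₁ p) (inj₂ (b , _ , _)) vd N
      with eqF-sound {x = p} (IsSubN.b≺c N) | eqF-sound {x = q} (IsSubN.a≺c N)
    ... | refl | refl = ⊥-elim (IsSubN.a⋢d N (proj₁ (subCover⇒⊏ (inj₁ p) vd (IsSubN.b≺d N))))
    IsSubN-diagonal (inj₂ _) (inj₁ _) (inj₂ _) _ N = ⊥-elim (IsSubN.a≺c N)
    IsSubN-diagonal va (inj₂ (_ , c , _)) (inj₁ q) (inj₁ d) N
      with eqF-sound {x = c} (IsSubN.b≺c N) | eqF-sound {x = c} (IsSubN.b≺d N)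
    ... | refl | refl = ⊥-elim (IsSubN.a⋢d N (proj₁ (subCover⇒⊏ va (inj₁ c) (IsSubN.a≺c N))))
    IsSubN-diagonal _ (inj₂ _) (inj₁ _) (inj₂ _) N = ⊥-elim (IsSubN.b≺d N)
    IsSubN-diagonal _ (inj₂ _) (inj₂ _) _ N = ⊥-elim (IsSubN.b≺c N)

    ¬new⊑new : ∀ {b c b′ c′} {t : T (K b c)} {t′ : T (K b′ c′)} → b ≢ b′ → ¬ T (R c b′) →
               ¬ T (subOrder {K} (inj₂ (b , c , t)) (inj₂ (b′ , c′ , t′)))
    ¬new⊑new {b} {c} {b′} {c′} b≢b′ c≰b′ p with ∨-elim {eqF b b′ ∧ eqF c c′} p
    ... | inj₁ e = b≢b′ (proj₁ (eqF²-sound e))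
    ... | inj₂ c≤b′ = c≰b′ c≤b′

    -- The two lower ends of the N are a, or the new vertex on a ≺ γ when that edge is
    -- subdivided; likewise d, or the new vertex on β ≺ d.
    witness-IsSubN : ∀ {β γ} → ¬ T (K β γ) → T (W K β γ) →
                     Σ (Vertex K) (λ va → Σ (Vertex K) (λ vd → IsSubN va (inj₁ β) (inj₁ γ) vd))
    witness-IsSubN {β} {γ} ¬βγ w = ends (W⇒witness {K} w)
      where
      β≺γ : T (cov R β γ)
      β≺γ = W⇒cov {K} w

      β⋖γ : T (subCover {K} (inj₁ β) (inj₁ γ))
      β⋖γ = ∧-intro β≺γ (not-intro ¬βγ)

      ends : Witness K β γ → Σ (Vertex K) (λ va → Σ (Vertex K) (λ vd → IsSubN va (inj₁ β) (inj₁ γ) vd))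
      ends (witness a d a≺γ β≺d a≢β d≢γ separated) with T? (K a γ) | T? (K β d)
      ... | yes aγ | yes βd = inj₂ (a , γ , aγ) , inj₂ (β , d , βd) , isSubN β⋖γ (eqF-refl γ) (eqF-refl β)
        (¬new⊑new {t = aγ} {t′ = βd} a≢β (lt-asym (cov⇒lt β≺γ)))
        (¬new⊑new {t = βd} {t′ = aγ} (a≢β ∘ sym) (cov-no-zigzag β≺γ a≺γ β≺d))
      ... | yes aγ | no ¬βd = inj₂ (a , γ , aγ) , inj₁ d , isSubN β⋖γ (eqF-refl γ) (∧-intro β≺d (not-intro ¬βd))
        (λ γ≤d → d≢γ (sym (cov-upper β≺d (cov⇒lt β≺γ) γ≤d))) (cov-no-zigzag β≺γ a≺γ β≺d)
      ... | no ¬aγ | yes βd = inj₁ a , inj₂ (β , d , βd) , isSubN β⋖γ (∧-intro a≺γ (not-intro ¬aγ)) (eqF-refl β)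
        (λ a≤β → a≢β (sym (cov-lower a≺γ a≤β (cov⇒lt β≺γ)))) (cov-no-zigzag β≺γ a≺γ β≺d)
      ... | no ¬aγ | no ¬βd = inj₁ a , inj₁ d , isSubN β⋖γ (∧-intro a≺γ (not-intro ¬aγ)) (∧-intro β≺d (not-intro ¬βd))
        ([ id , [ ⊥-elim ∘ ¬aγ , ⊥-elim ∘ ¬βd ]′ ]′ separated) (cov-no-zigzag β≺γ a≺γ β≺d)

  module SubdivisionDiagonals {K : BRel n} {m : ℕ} {Q : BRel m} {ι : Fin n → Fin m}
                              (S : IsSubdivision K Q ι) where
    open IsSubdivision S
    open IsSubdivisionProperties S
    open SubdivisionN onCovers

    from-subCover : ∀ {v w} → T (subCover v w) → T (cov Q (from v) (from w))
    from-subCover {v} {w} c = from-cov (subst₂ (λ v′ w′ → T (subCover v′ w′))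
      (sym (strictlyInverseˡ v)) (sym (strictlyInverseˡ w)) c)

    from-⋢ : ∀ {v w} → ¬ T (subOrder v w) → ¬ T (Q (from v) (from w))
    from-⋢ {v} {w} v⋢w q = v⋢w (subst₂ (λ v′ w′ → T (subOrder v′ w′))
      (strictlyInverseˡ v) (strictlyInverseˡ w) (to-order q))

    ι≡from : ∀ p → ι p ≡ from (inj₁ p)
    ι≡from p = trans (sym (strictlyInverseʳ (ι p))) (cong from (embeds p))

    isDiag-sound : ∀ {x y} → T (isDiag Q x y) → DiagonalOver K ι x y
    isDiag-sound p with isDiag-elim Q p
    ... | a , d , N with IsSubN-diagonal _ _ _ _ (record
      { b≺c = to-cov b≺c ; a≺c = to-cov a≺c ; b≺d = to-cov b≺d
      ; a⋢d = a≰d ∘ from-order ; d⋢a = d≰a ∘ from-order })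
      where open IsN N
    ...   | diagonalOver β γ x≡β y≡γ ¬βγ w = diagonalOver β γ
      (to-injective (trans x≡β (sym (embeds β)))) (to-injective (trans y≡γ (sym (embeds γ)))) ¬βγ w

    isDiag-complete : ∀ {β γ} → ¬ T (K β γ) → T (W K β γ) → T (isDiag Q (ι β) (ι γ))
    isDiag-complete {β} {γ} ¬βγ w with witness-IsSubN ¬βγ w
    ... | va , vd , N = subst₂ (λ x y → T (isDiag Q x y)) (sym (ι≡from β)) (sym (ι≡from γ))
      (isDiag-intro Q {a = from va} {d = from vd} (record
        { b≺c = from-subCover b≺c ; a≺c = from-subCover a≺c ; b≺d = from-subCover b≺d
        ; a≰d = from-⋢ a⋢d ; d≰a = from-⋢ d⋢a }))
      where open IsSubN N

module DiagonalClosure {n : ℕ} (R : BRel n) (isPoset : IsPoset R) where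
  open Diagonals R isPoset public

  ∅ : BRel n
  ∅ _ _ = false

  D₁ : BRel n
  D₁ = W ∅

  D₂ : BRel n
  D₂ β γ = D₁ β γ ∨ W D₁ β γ

  D₁-intro : ∀ {β γ a d} → T (cov R β γ) → T (cov R a γ) → T (cov R β d) → a ≢ β → d ≢ γ →
             ¬ T (R a d) → T (D₁ β γ)
  D₁-intro β≺γ a≺γ β≺d a≢β d≢γ a≰d = W-intro {∅} β≺γ (witness _ _ a≺γ β≺d a≢β d≢γ (inj₁ a≰d))

  D₁-incomparable : ∀ {β γ} (w : Witness ∅ β γ) → ¬ T (R (Witness.a w) (Witness.d w))
  D₁-incomparable (witness _ _ _ _ _ _ (inj₁ a≰d)) = a≰d
  D₁-incomparable (witness _ _ _ _ _ _ (inj₂ (inj₁ ())))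
  D₁-incomparable (witness _ _ _ _ _ _ (inj₂ (inj₂ ())))

  upper-covers-agree : ∀ {β γ a} → T (cov R β γ) → T (cov R a γ) → a ≢ β →
                       ¬ T (D₁ β γ) → ¬ T (D₁ a γ) →
                       ∀ {d} → T (cov R a d) → d ≢ γ → T (cov R β d)
  upper-covers-agree {β} {γ} {a} β≺γ a≺γ a≢β ¬βγ ¬aγ {d} a≺d d≢γ with T? (R β d)
  ... | no β≰d = ⊥-elim (¬aγ (D₁-intro a≺γ β≺γ a≺d (a≢β ∘ sym) d≢γ β≰d))
  ... | yes β≤d with cover-above (lt-intro β≤d λ β≡d →
    cov-nothing-between a≺γ β (subst (T ∘ lt R a) (sym β≡d) (cov⇒lt a≺d)) (cov⇒lt β≺γ))
  ...     | w , β≺w , w≤d with w ≟ γ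
  ...       | yes refl = ⊥-elim (d≢γ (sym (cov-upper a≺d (cov⇒lt a≺γ) w≤d)))
  ...       | no w≢γ with T? (R a w)
  ...         | no a≰w = ⊥-elim (¬βγ (D₁-intro β≺γ a≺γ β≺w a≢β w≢γ a≰w))
  ...         | yes a≤w with cov-squeeze a≺d a≤w w≤d
  ...           | inj₁ refl = ⊥-elim (cov-nothing-between β≺γ w (cov⇒lt β≺w) (cov⇒lt a≺γ))
  ...           | inj₂ refl = β≺w

  lower-covers-agree : ∀ {β γ d} → T (cov R β γ) → T (cov R β d) → d ≢ γ →
                       ¬ T (D₁ β γ) → ¬ T (D₁ β d) →
                       ∀ {a} → T (cov R a d) → a ≢ β → T (cov R a γ)
  lower-covers-agree {β} {γ} {d} β≺γ β≺d d≢γ ¬βγ ¬βd {a} a≺d a≢β with T? (R a γ)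
  ... | no a≰γ = ⊥-elim (¬βd (D₁-intro β≺d a≺d β≺γ a≢β (d≢γ ∘ sym) a≰γ))
  ... | yes a≤γ with cover-below (lt-intro a≤γ λ a≡γ →
    cov-nothing-between β≺d γ (cov⇒lt β≺γ) (subst (λ x → T (lt R x d)) a≡γ (cov⇒lt a≺d)))
  ...     | w , a≤w , w≺γ with w ≟ β
  ...       | yes refl = ⊥-elim (a≢β (sym (cov-lower a≺d a≤w (cov⇒lt β≺d))))
  ...       | no w≢β with T? (R w d)
  ...         | no w≰d = ⊥-elim (¬βγ (D₁-intro β≺γ w≺γ β≺d w≢β d≢γ w≰d))
  ...         | yes w≤d with cov-squeeze a≺d a≤w w≤d
  ...           | inj₁ refl = w≺γ
  ...           | inj₂ refl = ⊥-elim (cov-nothing-between β≺γ w (cov⇒lt β≺d) (cov⇒lt w≺γ))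

  -- A witness a₀, d₀ of β ≺ γ over D₂ whose edge a₀ ≺ γ (resp. β ≺ d₀) only enters D₂
  -- through W D₁ is traded, using the agreement of covers, for a witness over D₁.
  W-D₁-via-upper : ∀ {β γ a₀ d₀} → T (cov R β γ) → ¬ T (D₁ β γ) →
                   T (cov R a₀ γ) → T (cov R β d₀) → a₀ ≢ β → d₀ ≢ γ →
                   ¬ T (D₁ a₀ γ) → Witness D₁ a₀ γ → T (W D₁ β γ)
  W-D₁-via-upper β≺γ ¬βγ a₀≺γ β≺d₀ a₀≢β d₀≢γ ¬a₀γ (witness a₁ d₁ a₁≺γ a₀≺d₁ a₁≢a₀ d₁≢γ (inj₁ a₁≰d₁)) =
    ⊥-elim (¬a₀γ (D₁-intro a₀≺γ a₁≺γ a₀≺d₁ a₁≢a₀ d₁≢γ a₁≰d₁))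
  W-D₁-via-upper β≺γ ¬βγ a₀≺γ β≺d₀ a₀≢β d₀≢γ ¬a₀γ (witness a₁ d₁ a₁≺γ a₀≺d₁ a₁≢a₀ d₁≢γ (inj₂ (inj₁ a₁γ))) =
    W-intro {D₁} β≺γ (witness a₁ _ a₁≺γ β≺d₀ (λ { refl → ¬βγ a₁γ }) d₀≢γ (inj₂ (inj₁ a₁γ)))
  W-D₁-via-upper {β} {γ} {a₀} β≺γ ¬βγ a₀≺γ β≺d₀ a₀≢β d₀≢γ ¬a₀γ
                 (witness a₁ d₁ a₁≺γ a₀≺d₁ a₁≢a₀ d₁≢γ (inj₂ (inj₂ a₀d₁))) =
    W-intro {D₁} β≺γ (witness a₀ d₁ a₀≺γ (β≺ a₀≺d₁ d₁≢γ) a₀≢β d₁≢γ (inj₂ (inj₂ (βd₁ (W⇒witness {∅} a₀d₁)))))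
    where
    β≺ : ∀ {y} → T (cov R a₀ y) → y ≢ γ → T (cov R β y)
    β≺ = upper-covers-agree β≺γ a₀≺γ a₀≢β ¬βγ ¬a₀γ

    β≺′ : ∀ {y} → T (cov R a₀ y) → T (cov R β y)
    β≺′ {y} a₀≺y with y ≟ γ
    ... | yes refl = β≺γ
    ... | no y≢γ = β≺ a₀≺y y≢γ

    βd₁ : Witness ∅ a₀ d₁ → T (D₁ β d₁)
    βd₁ w@(witness x y x≺d₁ a₀≺y x≢a₀ y≢d₁ _) =
      D₁-intro (β≺ a₀≺d₁ d₁≢γ) x≺d₁ (β≺′ a₀≺y) (λ { refl → D₁-incomparable w (cov⇒le (β≺′ a₀≺y)) })
        y≢d₁ (D₁-incomparable w)

  W-D₁-via-lower : ∀ {β γ a₀ d₀} → T (cov R β γ) → ¬ T (D₁ β γ) →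
                   T (cov R a₀ γ) → T (cov R β d₀) → a₀ ≢ β → d₀ ≢ γ →
                   ¬ T (D₁ β d₀) → Witness D₁ β d₀ → T (W D₁ β γ)
  W-D₁-via-lower β≺γ ¬βγ a₀≺γ β≺d₀ a₀≢β d₀≢γ ¬βd₀ (witness a₁ d₁ a₁≺d₀ β≺d₁ a₁≢β d₁≢d₀ (inj₁ a₁≰d₁)) =
    ⊥-elim (¬βd₀ (D₁-intro β≺d₀ a₁≺d₀ β≺d₁ a₁≢β d₁≢d₀ a₁≰d₁))
  W-D₁-via-lower β≺γ ¬βγ a₀≺γ β≺d₀ a₀≢β d₀≢γ ¬βd₀ (witness a₁ d₁ a₁≺d₀ β≺d₁ a₁≢β d₁≢d₀ (inj₂ (inj₂ βd₁))) =
    W-intro {D₁} β≺γ (witness _ d₁ a₀≺γ β≺d₁ a₀≢β (λ { refl → ¬βγ βd₁ }) (inj₂ (inj₂ βd₁)))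
  W-D₁-via-lower {β} {γ} {a₀} {d₀} β≺γ ¬βγ a₀≺γ β≺d₀ a₀≢β d₀≢γ ¬βd₀
                 (witness a₁ d₁ a₁≺d₀ β≺d₁ a₁≢β d₁≢d₀ (inj₂ (inj₁ a₁d₀))) =
    W-intro {D₁} β≺γ (witness a₁ d₀ (≺γ a₁≺d₀ a₁≢β) β≺d₀ a₁≢β d₀≢γ (inj₂ (inj₁ (a₁γ (W⇒witness {∅} a₁d₀)))))
    where
    ≺γ : ∀ {x} → T (cov R x d₀) → x ≢ β → T (cov R x γ)
    ≺γ = lower-covers-agree β≺γ β≺d₀ d₀≢γ ¬βγ ¬βd₀

    ≺γ′ : ∀ {x} → T (cov R x d₀) → T (cov R x γ)
    ≺γ′ {x} x≺d₀ with x ≟ β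
    ... | yes refl = β≺γ
    ... | no x≢β = ≺γ x≺d₀ x≢β

    a₁γ : Witness ∅ a₁ d₀ → T (D₁ a₁ γ)
    a₁γ w@(witness x y x≺d₀ a₁≺y x≢a₁ y≢d₀ _) =
      D₁-intro (≺γ a₁≺d₀ a₁≢β) (≺γ′ x≺d₀) a₁≺y x≢a₁ (λ { refl → D₁-incomparable w (cov⇒le (≺γ′ x≺d₀)) })
        (D₁-incomparable w)

  W-D₁-of-D₂-witness : ∀ {β γ} → T (cov R β γ) → ¬ T (D₁ β γ) → Witness D₂ β γ → T (W D₁ β γ)
  W-D₁-of-D₂-witness β≺γ ¬βγ (witness a d a≺γ β≺d a≢β d≢γ (inj₁ a≰d)) =
    ⊥-elim (¬βγ (D₁-intro β≺γ a≺γ β≺d a≢β d≢γ a≰d))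
  W-D₁-of-D₂-witness {β} {γ} β≺γ ¬βγ (witness a d a≺γ β≺d a≢β d≢γ (inj₂ (inj₁ aγ))) = upper (T? (D₁ a γ))
    where
    upper : Dec (T (D₁ a γ)) → T (W D₁ β γ)
    upper (yes aγ∈D₁) = W-intro {D₁} β≺γ (witness a d a≺γ β≺d a≢β d≢γ (inj₂ (inj₁ aγ∈D₁)))
    upper (no ¬aγ) = W-D₁-via-upper β≺γ ¬βγ a≺γ β≺d a≢β d≢γ ¬aγ (W⇒witness {D₁} (∨-resolveˡ ¬aγ aγ))
  W-D₁-of-D₂-witness {β} {γ} β≺γ ¬βγ (witness a d a≺γ β≺d a≢β d≢γ (inj₂ (inj₂ βd))) = lower (T? (D₁ β d))
    where
    lower : Dec (T (D₁ β d)) → T (W D₁ β γ)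
    lower (yes βd∈D₁) = W-intro {D₁} β≺γ (witness a d a≺γ β≺d a≢β d≢γ (inj₂ (inj₂ βd∈D₁)))
    lower (no ¬βd) = W-D₁-via-lower β≺γ ¬βγ a≺γ β≺d a≢β d≢γ ¬βd (W⇒witness {D₁} (∨-resolveˡ ¬βd βd))

  D₂-closed : W D₂ ⊆ D₂
  D₂-closed {β} {γ} w = close (T? (D₁ β γ))
    where
    close : Dec (T (D₁ β γ)) → T (D₂ β γ)
    close (yes βγ) = ∨-inj₁ βγ
    close (no ¬βγ) = ∨-inj₂ {D₁ β γ} (W-D₁-of-D₂-witness (W⇒cov {D₂} w) ¬βγ (W⇒witness {D₂} w))

  D₂-least : ∀ {K} → W K ⊆ K → D₂ ⊆ K
  D₂-least {K} closed {β} {γ} p = [ D₁⊆K , closed ∘ W-mono {D₁} {K} D₁⊆K ]′ (∨-elim {D₁ β γ} p)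
    where
    D₁⊆K : D₁ ⊆ K
    D₁⊆K = closed ∘ W-mono {∅} {K} (λ ())

eqPair-sound : ∀ {k} {q r : Fin k × Fin k} → T (eqPair q r) → q ≡ r
eqPair-sound {q = x , y} {u , v} p with eqF-sound {x = x} (∧-proj₁ {eqF x u} p) | eqF-sound {x = y} (∧-proj₂ {eqF x u} p)
... | refl | refl = refl

eqPair-complete : ∀ {k} {q r : Fin k × Fin k} → q ≡ r → T (eqPair q r)
eqPair-complete {q = x , y} refl = ∧-intro (eqF-refl x) (eqF-refl y)

any-eqPair⁻ : ∀ {k} {q : Fin k × Fin k} L → T (any (eqPair q) L) → q ∈ L
any-eqPair⁻ L = Any.map eqPair-sound ∘ any⁻ _ L

any-eqPair⁺ : ∀ {k} {q : Fin k × Fin k} {L} → q ∈ L → T (any (eqPair q) L)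
any-eqPair⁺ = any⁺ _ ∘ Any.map eqPair-complete

lookup-injective : ∀ {A : Set} {xs : List A} → Unique xs → ∀ {i j} → lookup xs i ≡ lookup xs j → i ≡ j
lookup-injective (_ ∷ _) {zero} {zero} _ = refl
lookup-injective (x∉xs ∷ _) {zero} {suc j} e = ⊥-elim (All.lookup x∉xs (∈-lookup j) e)
lookup-injective (x∉xs ∷ _) {suc i} {zero} e = ⊥-elim (All.lookup x∉xs (∈-lookup i) (sym e))
lookup-injective (_ ∷ unique) {suc i} {suc j} e = cong suc (lookup-injective unique e)

data SplitView (m k : ℕ) : Fin (m + k) → Set where
  old : ∀ u → SplitView m k (u ↑ˡ k)
  new : ∀ j → SplitView m k (m ↑ʳ j)

splitView : ∀ m k x → SplitView m k x
splitView m k x = subst (SplitView m k) (join-splitAt m k x) (view (splitAt m x))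
  where
  view : ∀ s → SplitView m k (join m k s)
  view (inj₁ u) = old u
  view (inj₂ j) = new j

module AddingVertices {n : ℕ} (R : BRel n) (isPoset : IsPoset R) where
  open IsPoset isPoset using () renaming (refl to ≤-reflexive)
  open Diagonals R isPoset

  module OnDiagonals {K : BRel n} {m : ℕ} {Q : BRel m} {ι : Fin n → Fin m} (S : IsSubdivision K Q ι)
                     (L : List (Fin m × Fin m))
                     (diagonal : ∀ {e} → e ∈ L → T (isDiag Q (proj₁ e) (proj₂ e)))
                     (unique : Unique L) where
    open IsSubdivision S
    open IsSubdivisionProperties S
    open SubdivisionDiagonals S

    len : ℕ
    len = length L

    abstract
      diagonalAt : ∀ i → DiagonalOver K ι (proj₁ (lookup L i)) (proj₂ (lookup L i))
      diagonalAt i = isDiag-sound (diagonal (∈-lookup i))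

    βᵢ γᵢ : Fin len → Fin n
    βᵢ = DiagonalOver.β ∘ diagonalAt
    γᵢ = DiagonalOver.γ ∘ diagonalAt

    lookup≡ : ∀ i → lookup L i ≡ (ι (βᵢ i) , ι (γᵢ i))
    lookup≡ i = cong₂ _,_ (DiagonalOver.x≡ιβ (diagonalAt i)) (DiagonalOver.y≡ιγ (diagonalAt i))

    inL : BRel n
    inL β γ = any (eqPair (ι β , ι γ)) L

    K′ : BRel n
    K′ β γ = K β γ ∨ inL β γ

    position : ∀ {β γ} → T (inL β γ) → Fin len
    position {β} {γ} = Any.index ∘ any-eqPair⁻ {q = ι β , ι γ} L

    lookup-position : ∀ {β γ} (p : T (inL β γ)) → lookup L (position p) ≡ (ι β , ι γ)
    lookup-position {β} {γ} p = sym (lookup-index (any-eqPair⁻ {q = ι β , ι γ} L p))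

    position-lookup : ∀ i (p : T (inL (βᵢ i) (γᵢ i))) → position p ≡ i
    position-lookup i p = lookup-injective unique (trans (lookup-position p) (sym (lookup≡ i)))

    inL-sound : ∀ {β γ} (p : T (inL β γ)) → β ≡ βᵢ (position p) × γ ≡ γᵢ (position p)
    inL-sound p = let e = trans (sym (lookup-position p)) (lookup≡ (position p))
                  in ι-injective (cong proj₁ e) , ι-injective (cong proj₂ e)

    inL-complete : ∀ i → T (inL (βᵢ i) (γᵢ i))
    inL-complete i = any-eqPair⁺ (subst (_∈ L) (lookup≡ i) (∈-lookup i))

    K′-sound : ∀ {β γ} → T (K′ β γ) → T (K β γ) ⊎ T (W K β γ)
    K′-sound {β} {γ} t = map₂ inL-W (∨-elim {K β γ} t)
      where
      inL-W : T (inL β γ) → T (W K β γ)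
      inL-W p = subst₂ (λ b c → T (W K b c)) (sym (proj₁ (inL-sound p))) (sym (proj₂ (inL-sound p)))
        (DiagonalOver.witnessed (diagonalAt (position p)))

    onCovers′ : OnCovers K′
    onCovers′ = [ onCovers , W⇒cov {K} ]′ ∘ K′-sound

    lift : Vertex K → Vertex K′
    lift (inj₁ p) = inj₁ p
    lift (inj₂ (b , c , k)) = inj₂ (b , c , ∨-inj₁ k)

    newVertex : Fin len → Vertex K′
    newVertex i = inj₂ (βᵢ i , γᵢ i , ∨-inj₂ {K (βᵢ i) (γᵢ i)} (inL-complete i))

    to′ : Fin (m + len) → Vertex K′
    to′ = [ lift ∘ to , newVertex ]′ ∘ splitAt m

    from′ : Vertex K′ → Fin (m + len)
    from′ (inj₁ p) = from (inj₁ p) ↑ˡ len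
    from′ (inj₂ (b , c , t)) = fromEdge t (T? (K b c))
      where
      fromEdge : T (K′ b c) → Dec (T (K b c)) → Fin (m + len)
      fromEdge _ (yes k) = from (inj₂ (b , c , k)) ↑ˡ len
      fromEdge t (no ¬k) = m ↑ʳ position (∨-resolveˡ ¬k t)

    to′-old : ∀ u → to′ (u ↑ˡ len) ≡ lift (to u)
    to′-old u rewrite splitAt-↑ˡ m u len = refl

    to′-new : ∀ j → to′ (m ↑ʳ j) ≡ newVertex j
    to′-new j rewrite splitAt-↑ʳ m len j = refl

    to′-from′ : ∀ v → to′ (from′ v) ≡ v
    to′-from′ (inj₁ p) = trans (to′-old _) (cong lift (strictlyInverseˡ (inj₁ p)))
    to′-from′ (inj₂ (b , c , t)) with T? (K b c)
    ... | yes k = trans (to′-old _) (trans (cong lift (strictlyInverseˡ (inj₂ (b , c , k)))) (new-≡ refl refl))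
    ... | no ¬k = trans (to′-new _) (new-≡ (sym (proj₁ (inL-sound p))) (sym (proj₂ (inL-sound p))))
      where p = ∨-resolveˡ ¬k t

    from′-lift : ∀ v → from′ (lift v) ≡ from v ↑ˡ len
    from′-lift (inj₁ p) = refl
    from′-lift (inj₂ (b , c , k)) with T? (K b c)
    ... | yes k′ = cong (λ s → from (inj₂ (b , c , s)) ↑ˡ len) (T-irrelevant k′ k)
    ... | no ¬k = ⊥-elim (¬k k)

    from′-new : ∀ j → from′ (newVertex j) ≡ m ↑ʳ j
    from′-new j with T? (K (βᵢ j) (γᵢ j))
    ... | yes k = ⊥-elim (DiagonalOver.unsubdivided (diagonalAt j) k)
    ... | no ¬k = cong (m ↑ʳ_) (position-lookup j _)

    from′-to′ : ∀ x → from′ (to′ x) ≡ x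
    from′-to′ x with splitView m len x
    ... | old u = trans (cong from′ (to′-old u)) (trans (from′-lift (to u)) (cong (_↑ˡ len) (strictlyInverseʳ u)))
    ... | new j = trans (cong from′ (to′-new j)) (from′-new j)

    ι′ : Fin n → Fin (m + len)
    ι′ p = ι p ↑ˡ len

    vertices′ : Fin (m + len) ↔ Vertex K′
    vertices′ = mk↔ₛ′ to′ from′ to′-from′ from′-to′

    embeds′ : ∀ p → to′ (ι′ p) ≡ inj₁ p
    embeds′ p = trans (to′-old _) (cong lift (embeds p))

    -- addOn Q L is shown to be G by checking that its diagram lies between the covering
    -- relation of G and G itself.
    G : BRel (m + len)
    G x y = subOrder (to′ x) (to′ y)

    subdivisionG : IsSubdivision K′ G ι′
    subdivisionG = record
      { onCovers = onCovers′ ; vertices = vertices′ ; order = λ _ _ → refl ; embeds = embeds′ }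

    module GP = IsSubdivisionProperties subdivisionG

    addOnDiag-old-old : ∀ u v → addOnDiag Q L (u ↑ˡ len) (v ↑ˡ len) ≡ (cov Q u v ∧ not (any (eqPair (u , v)) L))
    addOnDiag-old-old u v rewrite splitAt-↑ˡ m u len | splitAt-↑ˡ m v len = refl

    addOnDiag-old-new : ∀ u j → addOnDiag Q L (u ↑ˡ len) (m ↑ʳ j) ≡ eqF u (proj₁ (lookup L j))
    addOnDiag-old-new u j rewrite splitAt-↑ˡ m u len | splitAt-↑ʳ m len j = refl

    addOnDiag-new-old : ∀ j v → addOnDiag Q L (m ↑ʳ j) (v ↑ˡ len) ≡ eqF v (proj₂ (lookup L j))
    addOnDiag-new-old j v rewrite splitAt-↑ʳ m len j | splitAt-↑ˡ m v len = refl

    addOnDiag-new-new : ∀ i j → addOnDiag Q L (m ↑ʳ i) (m ↑ʳ j) ≡ false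
    addOnDiag-new-new i j rewrite splitAt-↑ʳ m len i | splitAt-↑ʳ m len j = refl

    old-at-βᵢ : ∀ {u j} → u ≡ proj₁ (lookup L j) → to′ (u ↑ˡ len) ≡ inj₁ (βᵢ j)
    old-at-βᵢ {u} {j} e =
      trans (to′-old u) (trans (cong (lift ∘ to) (trans e (cong proj₁ (lookup≡ j)))) (cong lift (embeds _)))

    old-at-γᵢ : ∀ {v j} → v ≡ proj₂ (lookup L j) → to′ (v ↑ˡ len) ≡ inj₁ (γᵢ j)
    old-at-γᵢ {v} {j} e =
      trans (to′-old v) (trans (cong (lift ∘ to) (trans e (cong proj₂ (lookup≡ j)))) (cong lift (embeds _)))

    G-old : ∀ u v → G (u ↑ˡ len) (v ↑ˡ len) ≡ Q u v
    G-old u v = trans (cong₂ subOrder (to′-old u) (to′-old v)) (trans (subOrder-lift (to u) (to v)) (sym (order u v)))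
      where
      subOrder-lift : ∀ a b → subOrder (lift a) (lift b) ≡ subOrder a b
      subOrder-lift (inj₁ _) (inj₁ _) = refl
      subOrder-lift (inj₁ _) (inj₂ _) = refl
      subOrder-lift (inj₂ _) (inj₁ _) = refl
      subOrder-lift (inj₂ _) (inj₂ _) = refl

    G-at : ∀ {x y a b} → to′ x ≡ a → to′ y ≡ b → T (subOrder a b) → T (G x y)
    G-at refl refl p = p

    addOnDiag⊆G : ∀ {x y} → T (addOnDiag Q L x y) → T (G x y)
    addOnDiag⊆G {x} {y} e with splitView m len x | splitView m len y
    ... | old u | old v = subst T (sym (G-old u v)) (Q.cov⇒le (∧-proj₁ (subst T (addOnDiag-old-old u v) e)))
    ... | old u | new j = G-at (old-at-βᵢ (eqF-sound (subst T (addOnDiag-old-new u j) e))) (to′-new j)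
                               (≤-reflexive (βᵢ j))
    ... | new j | old v = G-at (to′-new j) (old-at-γᵢ (eqF-sound (subst T (addOnDiag-new-old j v) e)))
                               (≤-reflexive (γᵢ j))
    ... | new i | new j = ⊥-elim (subst T (addOnDiag-new-new i j) e)

    cov-at : ∀ {x y a b} → to′ x ≡ a → to′ y ≡ b → T (cov G x y) → T (subCover a b)
    cov-at refl refl = GP.to-cov

    subCover-lift⁻ : ∀ v w → T (subCover (lift v) (lift w)) → T (subCover v w)
    subCover-lift⁻ (inj₁ p) (inj₁ q) c =
      ∧-intro (∧-proj₁ {cov R p q} c) (not-intro (not-elim (∧-proj₂ {cov R p q} c) ∘ ∨-inj₁))
    subCover-lift⁻ (inj₁ _) (inj₂ _) c = c
    subCover-lift⁻ (inj₂ _) (inj₁ _) c = c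

    subCover-lift-new : ∀ v j → T (subCover (lift v) (newVertex j)) → v ≡ inj₁ (βᵢ j)
    subCover-lift-new (inj₁ p) j e = cong inj₁ (eqF-sound e)

    subCover-new-lift : ∀ j v → T (subCover (newVertex j) (lift v)) → v ≡ inj₁ (γᵢ j)
    subCover-new-lift j (inj₁ q) e = cong inj₁ (sym (eqF-sound e))

    cov-old-∉L : ∀ {u v} → T (cov G (u ↑ˡ len) (v ↑ˡ len)) → ¬ T (any (eqPair (u , v)) L)
    cov-old-∉L {u} {v} c p = not-elim (∧-proj₂ {cov R (βᵢ i) (γᵢ i)} uv) (∨-inj₂ {K (βᵢ i) (γᵢ i)} (inL-complete i))
      where
      u,v∈L = any-eqPair⁻ {q = u , v} L p
      i = Any.index u,v∈L
      uv = cov-at (old-at-βᵢ (cong proj₁ (lookup-index u,v∈L))) (old-at-γᵢ (cong proj₂ (lookup-index u,v∈L))) c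

    cov⊆addOnDiag : ∀ {x y} → T (cov G x y) → T (addOnDiag Q L x y)
    cov⊆addOnDiag {x} {y} c with splitView m len x | splitView m len y
    ... | old u | old v = subst T (sym (addOnDiag-old-old u v))
      (∧-intro (from-cov (subCover-lift⁻ (to u) (to v) (cov-at (to′-old u) (to′-old v) c))) (not-intro (cov-old-∉L c)))
    ... | old u | new j = subst T (sym (addOnDiag-old-new u j)) (eqF-complete (trans
      (to-injective (trans (subCover-lift-new (to u) j (cov-at (to′-old u) (to′-new j) c)) (sym (embeds (βᵢ j)))))
      (sym (cong proj₁ (lookup≡ j)))))
    ... | new j | old v = subst T (sym (addOnDiag-new-old j v)) (eqF-complete (trans
      (to-injective (trans (subCover-new-lift j (to v) (cov-at (to′-new j) (to′-old v) c)) (sym (embeds (γᵢ j)))))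
      (sym (cong proj₂ (lookup≡ j)))))
    ... | new i | new j = ⊥-elim (cov-at (to′-new i) (to′-new j) c)

    addOn-isSubdivision : IsSubdivision K′ (addOn Q L) ι′
    addOn-isSubdivision = record
      { onCovers = onCovers′
      ; vertices = vertices′
      ; order = FinitePoset.Closure.closure≡order G GP.isPosetQ (addOnDiag Q L) addOnDiag⊆G cov⊆addOnDiag
      ; embeds = embeds′
      }

allFin′≡allFin : ∀ n → allFin' n ≡ allFin n
allFin′≡allFin zero = refl
allFin′≡allFin (suc n) = cong (zero ∷_) (trans (cong (map suc) (allFin′≡allFin n)) (map-tabulate id suc))

allPairs≡cartesianProduct : ∀ n → allPairs n ≡ cartesianProduct (allFin n) (allFin n)
allPairs≡cartesianProduct n = subst (λ xs → allPairs n ≡ cartesianProduct xs xs) (allFin′≡allFin n) (rows (allFin' n))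
  where
  rows : ∀ xs → concatMap (λ b → map (b ,_) (allFin' n)) xs ≡ cartesianProduct xs (allFin' n)
  rows [] = refl
  rows (x ∷ xs) = cong (map (x ,_) (allFin' n) ++_) (rows xs)

∈-allPairs : ∀ {n} (e : Fin n × Fin n) → e ∈ allPairs n
∈-allPairs {n} (b , c) = subst (_ ∈_) (sym (allPairs≡cartesianProduct n)) (∈-cartesianProduct⁺ (∈-allFin b) (∈-allFin c))

allPairs-unique : ∀ n → Unique (allPairs n)
allPairs-unique n = subst Unique (sym (allPairs≡cartesianProduct n)) (cartesianProduct⁺ (allFin⁺ n) (allFin⁺ n))

module _ {m : ℕ} (Q : BRel m) where

  isDiagᵉ : Fin m × Fin m → Bool
  isDiagᵉ e = isDiag Q (proj₁ e) (proj₂ e)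

  diagList-sound : ∀ {e} → e ∈ diagList Q → T (isDiagᵉ e)
  diagList-sound = proj₂ ∘ ∈-filter⁻ (T? ∘ isDiagᵉ) {xs = allPairs m}

  diagList-complete : ∀ {e} → T (isDiagᵉ e) → e ∈ diagList Q
  diagList-complete {e} = ∈-filter⁺ (T? ∘ isDiagᵉ) (∈-allPairs e)

  diagList-unique : Unique (diagList Q)
  diagList-unique = filter⁺ (T? ∘ isDiagᵉ) (allPairs-unique m)

module Runs {n : ℕ} (R : BRel n) (isPoset : IsPoset R) where
  open DiagonalClosure R isPoset
  open AddingVertices R isPoset

  trivialSubdivision : IsSubdivision ∅ R id
  trivialSubdivision = record
    { onCovers = λ ()
    ; vertices = mk↔ₛ′ inj₁ [ id , (λ { (_ , _ , ()) }) ]′ (λ { (inj₁ p) → refl ; (inj₂ (_ , _ , ())) }) (λ _ → refl)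
    ; order = λ _ _ → refl
    ; embeds = λ _ → refl
    }

  IsSubdivision-cong : ∀ {K K′ m} {Q : BRel m} {ι} → (∀ b c → K b c ≡ K′ b c) →
                       IsSubdivision K Q ι → IsSubdivision K′ Q ι
  IsSubdivision-cong {K} {K′} K≡K′ S = record
    { onCovers = onCovers ∘ subst T (sym (K≡K′ _ _))
    ; vertices = ↔-trans vertices (mk↔ₛ′ (retag K≡K′) (retag (λ b c → sym (K≡K′ b c))) retag-retag retag-retag)
    ; order = λ x y → trans (order x y) (sym (subOrder-retag (to x) (to y)))
    ; embeds = cong (retag K≡K′) ∘ embeds
    }
    where
    open IsSubdivision S
    open Inverse vertices using (to)

    retag : ∀ {K₁ K₂ : BRel n} → (∀ b c → K₁ b c ≡ K₂ b c) → Vertex K₁ → Vertex K₂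
    retag e (inj₁ p) = inj₁ p
    retag e (inj₂ (b , c , t)) = inj₂ (b , c , subst T (e b c) t)

    retag-retag : ∀ {K₁ K₂ : BRel n} {e : ∀ b c → K₁ b c ≡ K₂ b c} {e′ : ∀ b c → K₂ b c ≡ K₁ b c} v →
                  retag e (retag e′ v) ≡ v
    retag-retag (inj₁ p) = refl
    retag-retag (inj₂ (b , c , t)) = new-≡ refl refl

    subOrder-retag : ∀ v w → subOrder (retag K≡K′ v) (retag K≡K′ w) ≡ subOrder v w
    subOrder-retag (inj₁ _) (inj₁ _) = refl
    subOrder-retag (inj₁ _) (inj₂ _) = refl
    subOrder-retag (inj₂ _) (inj₁ _) = refl
    subOrder-retag (inj₂ _) (inj₂ _) = refl

  vertex-count : ∀ {K m} {Q : BRel m} {ι} → IsSubdivision K Q ι → m ≤ n + n * n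
  vertex-count {K} S = injective⇒≤ {f = code ∘ to} (to-injective ∘ code-injective _ _)
    where
    open IsSubdivisionProperties S using (to; to-injective)

    code : Vertex K → Fin (n + n * n)
    code (inj₁ p) = p ↑ˡ (n * n)
    code (inj₂ (b , c , _)) = n ↑ʳ combine b c

    old≢new : ∀ {p q} → p ↑ˡ (n * n) ≡ n ↑ʳ q → ⊥
    old≢new {p} {q} e with trans (sym (splitAt-↑ˡ n p (n * n))) (trans (cong (splitAt n) e) (splitAt-↑ʳ n (n * n) q))
    ... | ()

    code-injective : ∀ v w → code v ≡ code w → v ≡ w
    code-injective (inj₁ p) (inj₁ q) e = cong inj₁ (↑ˡ-injective (n * n) p q e)
    code-injective (inj₁ p) (inj₂ _) e = ⊥-elim (old≢new e)
    code-injective (inj₂ _) (inj₁ q) e = ⊥-elim (old≢new (sym e))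
    code-injective (inj₂ (b , c , _)) (inj₂ (b′ , c′ , _)) e with combine-injective b c b′ c′ (↑ʳ-injective n _ _ e)
    ... | b≡b′ , c≡c′ = new-≡ b≡b′ c≡c′

  subdivisions-iso : ∀ {K m₁ m₂} {Q₁ : BRel m₁} {Q₂ : BRel m₂} {ι₁ ι₂} →
                     IsSubdivision K Q₁ ι₁ → IsSubdivision K Q₂ ι₂ → IsoFixing Q₁ ι₁ Q₂ ι₂ × m₁ ≡ m₂
  subdivisions-iso {ι₂ = ι₂} S₁ S₂ = iso , ↔⇒≡ bij
    where
    module S₁ = IsSubdivision S₁
    module S₂ = IsSubdivision S₂
    module V₂ = Inverse S₂.vertices

    bij = ↔-trans S₁.vertices (↔-sym S₂.vertices)

    iso : IsoFixing _ _ _ _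
    iso = record
      { bij = bij
      ; order = λ x y → trans (S₁.order x y) (sym (trans (S₂.order _ _)
          (cong₂ subOrder (V₂.strictlyInverseˡ _) (V₂.strictlyInverseˡ _))))
      ; fixesP = λ p → trans (cong V₂.from (trans (S₁.embeds p) (sym (S₂.embeds p)))) (V₂.strictlyInverseʳ (ι₂ p))
      }

  N-free-W-closed : ∀ {K m} {Q : BRel m} {ι} → IsSubdivision K Q ι → NFree Q → W K ⊆ K
  N-free-W-closed {K} {Q = Q} {ι} S nf {β} {γ} w = decide (T? (K β γ))
    where
    decide : Dec (T (K β γ)) → T (K β γ)
    decide (yes k) = k
    decide (no ¬k) =
      let a , d , N = isDiag-elim Q (SubdivisionDiagonals.isDiag-complete S ¬k w)
      in ⊥-elim (nf a (ι β) (ι γ) d (isN-complete Q N))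

  run-length : ∀ {m} {Q : BRel m} {m′} {Q′ : BRel m′} {k} → Run m Q m′ Q′ k → m′ ≡ m + k
  run-length done = sym (+-identityʳ _)
  run-length {m} (step _ _ _ r) = trans (run-length r) (+-assoc m 1 _)

  -- Every step subdivides an edge in W K, so the subdivided edges stay inside the
  -- W-closed set D₂.
  run-subdivision : ∀ {K m} {Q : BRel m} {ι} {m′} {Q′ : BRel m′} {k} → IsSubdivision K Q ι → K ⊆ D₂ →
                    (r : Run m Q m′ Q′ k) → Σ (BRel n) (λ K′ → IsSubdivision K′ Q′ (runEmb r ∘ ι) × K′ ⊆ D₂)
  run-subdivision S K⊆D₂ done = _ , S , K⊆D₂
  run-subdivision {K} {Q = Q} S K⊆D₂ (step b c bc r) =
    run-subdivision Step.addOn-isSubdivision ([ K⊆D₂ , D₂-closed ∘ W-mono {K} {D₂} K⊆D₂ ]′ ∘ Step.K′-sound) r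
    where
    single-diagonal : ∀ {e} → e ∈ (b , c) ∷ [] → T (isDiag Q (proj₁ e) (proj₂ e))
    single-diagonal (here refl) = bc

    module Step = OnDiagonals S ((b , c) ∷ []) single-diagonal (All.[] ∷ AllPairs.[])

  -- S_N subdivides exactly the edges in W K not yet subdivided.
  module SN-step {K m} {Q : BRel m} {ι} (S : IsSubdivision K Q ι) where
    open OnDiagonals S (diagList Q) (diagList-sound Q) (diagList-unique Q) public

    K′-complete : W K ⊆ K′
    K′-complete {β} {γ} w = decide (T? (K β γ))
      where
      decide : Dec (T (K β γ)) → T (K′ β γ)
      decide (yes k) = ∨-inj₁ k
      decide (no ¬k) = ∨-inj₂ {K β γ}
        (any-eqPair⁺ (diagList-complete Q (SubdivisionDiagonals.isDiag-complete S ¬k w)))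

  module SN₁ = SN-step trivialSubdivision
  module SN₂ = SN-step SN₁.addOn-isSubdivision

  SN₁⊆D₁ : SN₁.K′ ⊆ D₁
  SN₁⊆D₁ = [ (λ ()) , id ]′ ∘ SN₁.K′-sound

  SN₂≡D₂ : ∀ β γ → SN₂.K′ β γ ≡ D₂ β γ
  SN₂≡D₂ β γ = T-injective
    ([ ∨-inj₁ ∘ SN₁⊆D₁ , ∨-inj₂ {D₁ β γ} ∘ W-mono {SN₁.K′} {D₁} SN₁⊆D₁ ]′ ∘ SN₂.K′-sound)
    ([ ∨-inj₁ ∘ SN₁.K′-complete , SN₂.K′-complete ∘ W-mono {D₁} {SN₁.K′} SN₁.K′-complete ]′ ∘ ∨-elim {D₁ β γ})

  SN-SN-subdivision : IsSubdivision D₂ (SN (SN R)) (embSNSN R)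
  SN-SN-subdivision = IsSubdivision-cong SN₂≡D₂ SN₂.addOn-isSubdivision

  run-from-P : ∀ {m} {R′ : BRel m} {k} (r : Run n R m R′ k) →
               Σ (BRel n) (λ K → IsSubdivision K R′ (runEmb r) × K ⊆ D₂)
  run-from-P = run-subdivision trivialSubdivision (λ ())

  steps-bounded : ∀ {m} {R′ : BRel m} {k} → Run n R m R′ k → k ≤ n * n
  steps-bounded {k = k} r =
    +-cancelˡ-≤ n k (n * n) (subst (_≤ n + n * n) (run-length r) (vertex-count (proj₁ (proj₂ (run-from-P r)))))

  terminal-run : ∀ {m} {R′ : BRel m} {k} (r : Run n R m R′ k) → NFree R′ →
                 IsoFixing R′ (runEmb r) (SN (SN R)) (embSNSN R) × (n + k ≡ sizeSN (SN R))
  terminal-run r nf =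
    let K , S , K⊆D₂ = run-from-P r
        K≡D₂ = λ β γ → T-injective K⊆D₂ (D₂-least (N-free-W-closed S nf))
        iso , size≡ = subdivisions-iso (IsSubdivision-cong K≡D₂ S) SN-SN-subdivision
    in iso , trans (sym (run-length r)) size≡

theorem2 : (n : ℕ) (R : BRel n) → IsPoset R →
    (Σ ℕ (λ K → ∀ {m} {R' : BRel m} {k} → Run n R m R' k → k ≤ K))
    × (∀ {m} {R' : BRel m} {k} (r : Run n R m R' k) → NFree R' →
        IsoFixing R' (runEmb r) (SN (SN R)) (embSNSN R) × (n + k ≡ sizeSN (SN R)))
theorem2 n R isPoset = (n * n , steps-bounded) , terminal-run
  where open Runs R isPoset
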